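{- Let $f:\mathbb N\to\{0,1\}$ be a function in the ground model and let $\theta\in\mathrm{PL}$ be a closed term with $\theta\Vdash\exists n^{\mathrm{int}}(f(n)=1)$. Then $\theta\star\mathsf p\cdot\pi_0\succ\mathsf p\star\underline n\cdot\varpi$ for some stack $\varpi$ and some $n\in\mathbb N$ with $f(n)=1$.
   Context: Fix an integer $N\ge 0$. The BBC realizability algebra $(\Lambda,\Pi,\perp\!\!\!\perp)$: terms $\Lambda$ form the smallest set containing constants $\mathsf B,\mathsf C,\mathsf I,\mathsf K,\mathsf W,\mathsf{cc},\mathsf A$ and $\mathsf p,\mathsf q_0,\dots,\mathsf q_N$, closed under application $(\xi)\eta$, and such that to every sequence $(\xi_i)_{i\in\mathbb N}$ of closed terms (no occurrence of $\mathsf p,\mathsf q_0,\dots,\mathsf q_N$) is associated injectively and well-foundedly a new constant $\bigwedge_i\xi_i$; $\mathrm{PL}$ is the set of closed terms. Stacks: $t_0\cdot\ldots\cdot t_{n-1}\cdot\pi_0$, $\pi_0$ the empty stack. Continuations $\mathsf k_{\pi_0}=\mathsf A$, $\mathsf k_{t\cdot\pi}=(\ell_t)\mathsf k_\pi$, $\ell_t=((\mathsf C)(\mathsf B)\mathsf C\mathsf B)t$; integers $\underline 0=(\mathsf K)\mathsf I$, $\underline{n+1}=(\sigma)\underline n$, $\sigma=(\mathsf B\mathsf W)(\mathsf C)(\mathsf B)\mathsf B\mathsf B$. Execution $\succ$: least preorder with $(\xi)\eta\star\pi\succ\xi\star\eta\cdot\pi$; $\mathsf B\star\xi\cdot\eta\cdot\zeta\cdot\pi\succ\xi\star(\eta)\zeta\cdot\pi$;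 $\mathsf C\star\xi\cdot\eta\cdot\zeta\cdot\pi\succ\xi\star\zeta\cdot\eta\cdot\pi$; $\mathsf I\star\xi\cdot\pi\succ\xi\star\pi$; $\mathsf K\star\xi\cdot\eta\cdot\pi\succ\xi\star\pi$; $\mathsf W\star\xi\cdot\eta\cdot\pi\succ\xi\star\eta\cdot\eta\cdot\pi$; $\mathsf{cc}\star\xi\cdot\pi\succ\xi\star\mathsf k_\pi\cdot\pi$; $\mathsf A\star\xi\cdot\pi\succ\xi\star\pi_0$; $\bigwedge_i\xi_i\star\underline n\cdot\pi\succ\xi_n\star\pi$. Pole $\perp\!\!\!\perp=\{\xi\star\pi:\exists\varpi,\ \xi\star\pi\succ\mathsf p\star\varpi\}$. Realizability ($\xi\Vdash F$ iff $\xi\star\pi\in\perp\!\!\!\perp$ for all $\pi\in\|F\|$) is Krivine's classical realizability interpretation; relevant clauses: $\|\bot\|=\Pi$, $\|\top\|=\emptyset$, $\|A\to B\|=\{\eta\cdot\pi:\eta\Vdash A,\pi\in\|B\|\}$, $\|\forall n^{\mathrm{int}}F[n]\|=\{\underline n\cdot\pi:n\in\mathbb N,\pi\in\|F[n]\|\}$; the formula $f(n)\neq1$ has falsity value $\Pi$ (i.e. is $\bot$) if $f(n)=1$ and $\emptyset$ (i.e. is $\top$) otherwise; $\neg A$ is $A\to\bot$ and $\exists n^{\mathrm{int}}(f(n)=1)$ is $\neg\forall n^{\mathrm{int}}(f(n)\neq1)$. -}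

-- BBC realizability algebra, parameterised by the integer N ≥ 0
-- (the constants q₀,…,q_N are indexed by Fin (suc N)).
module Defs where

open import Data.Nat using (ℕ; zero; suc)
import Data.Unit
import Data.Fin as Fin
open import Data.Fin using (Fin)
open import Data.List using (List; []; _∷_)
open import Data.Product using (Σ; _×_; _,_; ∃)
open import Relation.Binary.PropositionalEquality using (_≡_)
open import Relation.Binary.Construct.Closure.ReflexiveTransitive using (Star)

module _ (N : ℕ) where

  -- Terms Λ together with the predicate "closed" (no occurrence of p, q_i),
  -- defined inductive-inductively since ⋀ takes a sequence of closed terms.
  data Λ : Set
  data Closed : Λ → Set

  infixl 9 _·_

  data Λ where
    B C I K W cc A : Λ
    p : Λ
    q : Fin (suc N) → Λ
    _·_ : Λ → Λ → Λ
    ⋀ : (ξ : ℕ → Λ) → (∀ i → Closed (ξ i)) → Λ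

  data Closed where
    cB : Closed B
    cC : Closed C
    cI : Closed I
    cK : Closed K
    cW : Closed W
    ccc : Closed cc
    cA : Closed A
    capp : ∀ {ξ η} → Closed ξ → Closed η → Closed (ξ · η)
    c⋀ : ∀ {ξ} (c : ∀ i → Closed (ξ i)) → Closed (⋀ ξ c)

  PL : Set
  PL = Σ Λ Closed

  -- Stacks t₀ · … · t_{n-1} · π₀  (π₀ = [])
  Π : Set
  Π = List Λ

  ℓ : Λ → Λ
  ℓ t = (C · (B · C · B)) · t

  k : Π → Λ
  k [] = A
  k (t ∷ π) = ℓ t · k π

  σ : Λ
  σ = (B · W) · (C · (B · B · B))

  num : ℕ → Λ
  num zero = K · I
  num (suc n) = σ · num n

  Process : Set
  Process = Λ × Π

  data _⟶_ : Process → Process → Set where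
    push : ∀ {ξ η π} → (ξ · η , π) ⟶ (ξ , η ∷ π)
    stepB : ∀ {ξ η ζ π} → (B , ξ ∷ η ∷ ζ ∷ π) ⟶ (ξ , (η · ζ) ∷ π)
    stepC : ∀ {ξ η ζ π} → (C , ξ ∷ η ∷ ζ ∷ π) ⟶ (ξ , ζ ∷ η ∷ π)
    stepI : ∀ {ξ π} → (I , ξ ∷ π) ⟶ (ξ , π)
    stepK : ∀ {ξ η π} → (K , ξ ∷ η ∷ π) ⟶ (ξ , π)
    stepW : ∀ {ξ η π} → (W , ξ ∷ η ∷ π) ⟶ (ξ , η ∷ η ∷ π)
    stepcc : ∀ {ξ π} → (cc , ξ ∷ π) ⟶ (ξ , k π ∷ π)
    stepA : ∀ {ξ π} → (A , ξ ∷ π) ⟶ (ξ , [])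
    step⋀ : ∀ {ξ c n π} → (⋀ ξ c , num n ∷ π) ⟶ (ξ n , π)

  _≻_ : Process → Process → Set
  _≻_ = Star _⟶_

  Pole : Process → Set
  Pole (ξ , π) = ∃ λ ϖ → (ξ , π) ≻ (p , ϖ)

  Falsity : Set₁
  Falsity = Π → Set

  _⊩_ : Λ → Falsity → Set
  ξ ⊩ F = ∀ π → F π → Pole (ξ , π)

  ⟦⊥⟧ : Falsity
  ⟦⊥⟧ π = Data.Unit.⊤

  _⇒_ : Falsity → Falsity → Falsity
  (F ⇒ G) π = ∃ λ η → ∃ λ π' → (π ≡ η ∷ π') × (η ⊩ F) × G π'

  ¬' : Falsity → Falsity
  ¬' F = F ⇒ ⟦⊥⟧

  ∀int : (ℕ → Falsity) → Falsity
  ∀int F π = ∃ λ n → ∃ λ π' → (π ≡ num n ∷ π') × F n π'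

  -- ‖ f(n) ≠ 1 ‖ = Π if f(n) = 1, ∅ otherwise
  ⟦≠1⟧ : (ℕ → Fin 2) → ℕ → Falsity
  ⟦≠1⟧ f n π = f n ≡ Fin.suc Fin.zero

  -- ∃ n^int (f(n) = 1)  :=  ¬ ∀ n^int (f(n) ≠ 1)
  ⟦∃=1⟧ : (ℕ → Fin 2) → Falsity
  ⟦∃=1⟧ f = ¬' (∀int (⟦≠1⟧ f))

module Submission where

-- Since p ⋆ π is in the pole for every π, the stack p·π₀ lies in
-- ‖∃n(f(n)=1)‖, so θ ⋆ p·π₀ ≻ p ⋆ ϖ for some ϖ.  To learn what ϖ looks like
-- we replace p by the term  η = (C)L p,  L = ⋀ₙ g(f(n)),  where g(1) = I
-- and g(0) = ⋀ᵢ B.  This η realizes ∀n(f(n)≠1), so θ ⋆ η·π₀ reaches p too.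

open import Defs
open import Data.Nat using (ℕ)
open import Data.Fin using (Fin; zero; suc)
open import Data.List using (List; []; _∷_; map)
open import Data.Product using (_×_; _,_; ∃; proj₁)
open import Data.Unit using (tt)
open import Data.Empty using (⊥-elim)
open import Data.List.Properties using (∷-injective)
open import Relation.Nullary using (¬_)
open import Relation.Binary.PropositionalEquality
  using (_≡_; _≢_; refl; sym; cong; cong₂; subst; subst₂)
open import Relation.Binary.Construct.Closure.ReflexiveTransitive using (ε; _◅_)

module _ {N : ℕ} where

  infix 4 _⇝_ _⇝*_

  _⇝_ : Process N → Process N → Set
  _⇝_ = _⟶_ N

  _⇝*_ : Process N → Process N → Set
  _⇝*_ = _≻_ N

  num-closed : ∀ n → Closed N (num N n)
  num-closed ℕ.zero = capp cK cI
  num-closed (ℕ.suc n) =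
    capp (capp (capp cB cW) (capp cC (capp (capp cB cB) cB))) (num-closed n)

  p≢num : ∀ n → p ≢ num N n
  p≢num n e = p-not-closed (subst (Closed N) (sym e) (num-closed n))
    where
      p-not-closed : ¬ Closed N p
      p-not-closed ()

  -- n ↦ n̲ is injective; this makes the ⋀-rule deterministic.
  num-injective : ∀ {m n} → num N m ≡ num N n → m ≡ n
  num-injective {ℕ.zero}  {ℕ.zero}  _ = refl
  num-injective {ℕ.suc m} {ℕ.suc n} e = cong ℕ.suc (num-injective (argument e))
    where
      argument : ∀ {a b c d : Λ N} → a · b ≡ c · d → b ≡ d
      argument refl = refl

  ⋀-step-inversion : ∀ {ξ c a π t} → (⋀ ξ c , a ∷ π) ⇝ t →
    ∃ λ n → (a ≡ num N n) × (t ≡ (ξ n , π))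
  ⋀-step-inversion (step⋀ {n = n}) = n , refl , refl

  deterministic : ∀ {s t t'} → s ⇝ t → s ⇝ t' → t ≡ t'
  deterministic push   push   = refl
  deterministic stepB  stepB  = refl
  deterministic stepC  stepC  = refl
  deterministic stepI  stepI  = refl
  deterministic stepK  stepK  = refl
  deterministic stepW  stepW  = refl
  deterministic stepcc stepcc = refl
  deterministic stepA  stepA  = refl
  deterministic (step⋀ {n = m}) r with ⋀-step-inversion r
  ... | n , numeral-eq , refl with num-injective {m} {n} numeral-eq
  ...   | refl = refl

  -- A process in the pole stays in the pole along any execution: p ⋆ ϖ
  -- has no successor, so the run reaching p passes through every successor.
  pole-forward : ∀ {s u} → Pole N s → s ⇝* u → Pole N u
  pole-forward h ε = h
  pole-forward (ϖ , ε) (() ◅ _)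
  pole-forward (ϖ , r' ◅ rs') (r ◅ rs) with deterministic r r'
  ... | refl = pole-forward (ϖ , rs') rs

  ⋀-pole : ∀ {ξ c a π} → Pole N (⋀ ξ c , a ∷ π) →
    ∃ λ n → (a ≡ num N n) × Pole N (ξ n , π)
  ⋀-pole (ϖ , r ◅ rs) with ⋀-step-inversion r
  ... | n , a≡n , refl = n , a≡n , ϖ , rs

  module Substitution (η : Λ N) where

    -- t[η/p]; the constants ⋀ξ are untouched since the ξᵢ are closed.
    sub : Λ N → Λ N
    sub B       = B
    sub C       = C
    sub I       = I
    sub K       = K
    sub W       = W
    sub cc      = cc
    sub A       = A
    sub p       = η
    sub (q i)   = q i
    sub (x · y) = sub x · sub y
    sub (⋀ ξ c) = ⋀ ξ c

    subΠ : List (Λ N) → List (Λ N)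
    subΠ = map sub

    sub-closed : ∀ {t} → Closed N t → sub t ≡ t
    sub-closed cB         = refl
    sub-closed cC         = refl
    sub-closed cI         = refl
    sub-closed cK         = refl
    sub-closed cW         = refl
    sub-closed ccc        = refl
    sub-closed cA         = refl
    sub-closed (capp a b) = cong₂ _·_ (sub-closed a) (sub-closed b)
    sub-closed (c⋀ c)     = refl

    sub-k : ∀ π → sub (k N π) ≡ k N (subΠ π)
    sub-k []      = refl
    sub-k (t ∷ π) = cong (ℓ N (sub t) ·_) (sub-k π)

    -- Each execution rule is stable under substitution; for the ⋀-rule this
    -- uses that numerals and the ξₙ are closed.
    simulation-step : ∀ {t π t' π'} → (t , π) ⇝ (t' , π') →
      (sub t , subΠ π) ⇝ (sub t' , subΠ π')
    simulation-step push   = push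
    simulation-step stepB  = stepB
    simulation-step stepC  = stepC
    simulation-step stepI  = stepI
    simulation-step stepK  = stepK
    simulation-step stepW  = stepW
    simulation-step stepA  = stepA
    simulation-step (stepcc {ξ} {π}) =
      subst (λ κ → (cc , sub ξ ∷ subΠ π) ⇝ (sub ξ , κ ∷ subΠ π))
            (sym (sub-k π)) stepcc
    simulation-step (step⋀ {ξ} {c} {n} {π}) =
      subst₂ (λ a t → (⋀ ξ c , a ∷ subΠ π) ⇝ (t , subΠ π))
             (sym (sub-closed (num-closed n))) (sym (sub-closed (c n))) step⋀

    simulation : ∀ {t π t' π'} → (t , π) ⇝* (t' , π') →
      (sub t , subΠ π) ⇝* (sub t' , subΠ π')
    simulation ε        = ε
    simulation (r ◅ rs) = simulation-step r ◅ simulation rs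

    sub-reflects-closed : ¬ Closed N η → ∀ x {t} → Closed N t → sub x ≡ t → x ≡ t
    sub-reflects-closed _ B       _ e = e
    sub-reflects-closed _ C       _ e = e
    sub-reflects-closed _ I       _ e = e
    sub-reflects-closed _ K       _ e = e
    sub-reflects-closed _ W       _ e = e
    sub-reflects-closed _ cc      _ e = e
    sub-reflects-closed _ A       _ e = e
    sub-reflects-closed η-open p  ct refl = ⊥-elim (η-open ct)
    sub-reflects-closed _ (q i)   _ e = e
    sub-reflects-closed η-open (x · y) (capp cx cy) refl =
      cong₂ _·_ (sub-reflects-closed η-open x cx refl)
                (sub-reflects-closed η-open y cy refl)
    sub-reflects-closed _ (⋀ ξ c) _ e = e

    subΠ-numeral-head : ¬ Closed N η → ∀ ϖ {n π} → subΠ ϖ ≡ num N n ∷ π →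
      ∃ λ ϖ' → ϖ ≡ num N n ∷ ϖ'
    subΠ-numeral-head η-open (b ∷ ϖ') {n} e =
      ϖ' , cong (_∷ ϖ') (sub-reflects-closed η-open b (num-closed n) b≡n)
      where
        b≡n : sub b ≡ num N n
        b≡n = proj₁ (∷-injective e)

  p-realizes : ∀ F → _⊩_ N p F
  p-realizes F π _ = π , ε

  refutation-stack : ∀ {η F} → _⊩_ N η F → ¬' N F (η ∷ [])
  refutation-stack {η} h = η , [] , refl , h , tt

  -- The test term η = (C)L p for f, where L = ⋀ₙ g(f(n)): on n̲·π it
  -- behaves as g(f(n)) ⋆ p·π, i.e. as p ⋆ π when f(n) = 1 and as the
  -- stuck process ⋀ᵢB ⋆ p·π when f(n) = 0.
  module Refuter (f : ℕ → Fin 2) where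

    g : Fin 2 → Λ N
    g zero       = ⋀ (λ _ → B) (λ _ → cB)
    g (suc zero) = I

    g-closed : ∀ b → Closed N (g b)
    g-closed zero       = c⋀ (λ _ → cB)
    g-closed (suc zero) = cI

    L : Λ N
    L = ⋀ (λ n → g (f n)) (λ n → g-closed (f n))

    η : Λ N
    η = C · L · p

    η-not-closed : ¬ Closed N η
    η-not-closed (capp _ ())

    g-pole : ∀ b {π} → Pole N (g b , p ∷ π) → b ≡ suc zero
    g-pole zero h with ⋀-pole h
    ... | n , p≡n , _ = ⊥-elim (p≢num n p≡n)
    g-pole (suc zero) _ = refl

    η-realizes : _⊩_ N η (∀int N (⟦≠1⟧ N f))
    η-realizes _ (n , π , refl , fn≡1) =
      π , push ◅ push ◅ stepC ◅ step⋀ ◅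
          subst (λ b → (g b , p ∷ π) ⇝* (p , π)) (sym fn≡1) (stepI ◅ ε)

    η-pole : ∀ {π} → Pole N (η , π) →
      ∃ λ n → ∃ λ π' → (π ≡ num N n ∷ π') × (f n ≡ suc zero)
    η-pole {[]} (_ , push ◅ push ◅ () ◅ _)
    η-pole {b ∷ π} (ϖ , push ◅ push ◅ stepC ◅ rs) with ⋀-pole (ϖ , rs)
    ... | n , b≡n , h = n , π , cong (_∷ π) b≡n , g-pole (f n) h

proposition4 : (N : ℕ) (f : ℕ → Fin 2) (θ : Λ N) → Closed N θ →
    _⊩_ N θ (⟦∃=1⟧ N f) →
    ∃ λ (n : ℕ) → ∃ λ (ϖ : List (Λ N)) →
    (f n ≡ suc zero) × _≻_ N (θ , p ∷ []) (p , num N n ∷ ϖ)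
proposition4 N f θ θ-closed θ⊩ =
  let ϖ , θ⋆p↠p = θ⊩ (p ∷ []) (refutation-stack (p-realizes _))
      θ⋆η↠η = subst (λ t → _≻_ N (t , η ∷ []) (η , subΠ ϖ))
                    (sub-closed θ-closed) (simulation θ⋆p↠p)
      θ⋆η-pole = θ⊩ (η ∷ []) (refutation-stack η-realizes)
      n , π' , ϖ[η/p]≡ , fn≡1 = η-pole (pole-forward θ⋆η-pole θ⋆η↠η)
      ϖ' , ϖ≡ = subΠ-numeral-head η-not-closed ϖ ϖ[η/p]≡
  in n , ϖ' , fn≡1 , subst (λ ρ → _≻_ N (θ , p ∷ []) (p , ρ)) ϖ≡ θ⋆p↠p
  where
    open Refuter {N} f
    open Substitution η
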